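{- Let $G$ be a digraph and let $v\in V(G)$ be a vertex which is the target of exactly $k\geq 2$ edges $e_1,\dots,e_k$. Let $G_v^{k}$ be the graph obtained from $G$ by deleting the edges $e_1,\dots,e_k$ (keeping all vertices), and for $h=1,\dots,k$ let $G_v^{(h)}\coloneqq G_v^{k}\cup e_h$. Then there is an isomorphism of posets \[P(G)\cong \nabla_{P(G_v^{k})}\left(P(G_v^{(1)}),\dots,P(G_v^{(k)})\right),\] i.e. the path poset of $G$ is isomorphic to the iterated gluing of the path posets $P(G_v^{(1)}),\dots,P(G_v^{(k)})$ along their common subposet $P(G_v^{k})$.
   Context: A digraph $G=(V,E)$ consists of a finite set $V$ of vertices and a set of edges $E\subseteq (V\times V)\setminus\{(v,v)\mid v\in V\}$; for $e=(v,w)$, $s(e)=v$ is its source and $t(e)=w$ its target. A subgraph $H$ of $G$ is spanning if $V(H)=V(G)$. A simple path is a sequence of edges $e_1,\dots,e_n$ with $s(e_{i+1})=t(e_i)$, no vertex encountered twice, and $s(e_1)\neq t(e_n)$. A multipath of $G$ is a spanning subgraph each of whose connected components (connectedness of the underlying undirected graph) is either a single vertex or has edges which, in some order, form a simple path. The path poset $P(G)$ is the set of multipaths of $G$ partially ordered by the relation "is a subgraph of". If $G'$ is a spanning subgraph of $G$, then $P(G')$ is naturally a downward closed subposet of $P(G)$. Gluing of posets: if $P_1,\dots,P_k$ are posets each containing a common poset $Q$ as a subposet, the gluing $\nabla_Q(P_1,\dots,P_k)$ is the poset whose Hasse diagram is obtained from the Hasse diagrams of $P_1,\dots,P_k$ by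 identifying their copies of the Hasse diagram of $Q$ (its underlying set is the disjoint union of the $P_i$ with the copies of $Q$ identified). -}

module Defs where

open import Data.Nat using (ℕ; _≤_)
open import Data.Fin using (Fin; _≟_)
open import Data.Bool using (Bool; T; _∧_; _∨_; not; true; false)
open import Data.Bool.Properties using (T-∨)
open import Data.Vec using (Vec; lookup)
open import Data.List using (List; []; _∷_; length)
open import Data.List.Relation.Unary.Unique.Propositional using (Unique)
open import Data.Product using (Σ; Σ-syntax; _×_; _,_)
open import Data.Sum using (_⊎_; inj₁; inj₂)
open import Data.Empty using (⊥)
open import Relation.Nullary using (¬_)
open import Relation.Nullary.Decidable using (⌊_⌋)
open import Relation.Binary.PropositionalEquality using (_≡_; _≢_; refl)
open import Relation.Binary.Construct.Closure.ReflexiveTransitive using (Star)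
open import Function.Bundles using (Equivalence)

record Digraph (n : ℕ) : Set where
  field
    adj      : Fin n → Fin n → Bool
    loopless : ∀ a → adj a a ≡ false

open Digraph public

Edge : ∀ {n} → Digraph n → Fin n → Fin n → Set
Edge G a b = T (adj G a b)

-- Spanning subgraphs of a digraph on Fin n, encoded by adjacency matrices
-- (so that equality of subgraphs is propositional equality).

Mat : ℕ → Set
Mat n = Vec (Vec Bool n) n

EdgeM : ∀ {n} → Mat n → Fin n → Fin n → Set
EdgeM M a b = T (lookup (lookup M a) b)

Adj : ∀ {n} → Mat n → Fin n → Fin n → Set
Adj M a b = EdgeM M a b ⊎ EdgeM M b a

Conn : ∀ {n} → Mat n → Fin n → Fin n → Set
Conn M = Star (Adj M)

Consec : ∀ {n} → List (Fin n) → Fin n → Fin n → Set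
Consec (x ∷ y ∷ xs) a b = (a ≡ x × b ≡ y) ⊎ Consec (y ∷ xs) a b
Consec _            a b = ⊥

-- The connected component of v (in the spanning subgraph M) is either the
-- single vertex v, or its edges, in some order, form a simple path: a vertex
-- sequence x₀ x₁ … xₘ (m ≥ 1) with no vertex repeated (this includes
-- s(e₁) ≠ t(eₘ)) whose edges (xᵢ , xᵢ₊₁) are exactly the edges of the
-- component.
ComponentOK : ∀ {n} → Mat n → Fin n → Set
ComponentOK {n} M v =
  (∀ w → Conn M v w → w ≡ v)
  ⊎ Σ[ xs ∈ List (Fin n) ]
      ( (2 ≤ length xs)
      × Unique xs
      × (∀ a b → (EdgeM M a b × Conn M v a) → Consec xs a b)
      × (∀ a b → Consec xs a b → (EdgeM M a b × Conn M v a)) )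

IsMultipath : ∀ {n} → Mat n → Set
IsMultipath M = ∀ v → ComponentOK M v

SubOf : ∀ {n} → Mat n → Digraph n → Set
SubOf M G = ∀ a b → EdgeM M a b → Edge G a b

-- The path poset P(G): multipaths of G ordered by "is a subgraph of".
-- Proof fields are irrelevant, so two multipaths are equal iff their
-- edge sets (adjacency matrices) are equal.

record Multipath {n} (G : Digraph n) : Set where
  constructor mpath
  field
    mat       : Mat n
    .subgraph : SubOf mat G
    .ismp     : IsMultipath mat

open Multipath public

_⊑_ : ∀ {n} {G : Digraph n} → Multipath G → Multipath G → Set
H ⊑ K = ∀ a b → EdgeM (mat H) a b → EdgeM (mat K) a b

_⊆G_ : ∀ {n} → Digraph n → Digraph n → Set
G' ⊆G G = ∀ a b → Edge G' a b → Edge G a b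

embedP : ∀ {n} {G' G : Digraph n} → G' ⊆G G → Multipath G' → Multipath G
embedP s (mpath M p q) = mpath M (λ a b e → s a b (p a b e)) q

-- Gluing ∇_Q(P₁,…,P_k) of posets (with equality _≡_) along a common
-- subposet Q, given by inclusions ι i : Q → P i.  Underlying set: the
-- disjoint union of the P i with the copies of Q identified, realised as
-- Q ⊎ Σ i (P i ∖ ι i Q).  Order: the reflexive-transitive closure of the
-- union of the orders of the P i (equivalently of their Hasse diagrams
-- glued along that of Q).

module Gluing {k : ℕ} (Q : Set) (P : Fin k → Set)
              (_≤_ : ∀ i → P i → P i → Set) (ι : ∀ i → Q → P i) where

  -- elements of P i not in (the copy of) Q; the proof is irrelevant so
  -- that such elements are equal iff their underlying elements are
  record Outside (i : Fin k) : Set where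
    constructor out
    field
      elt    : P i
      .notQ  : ∀ q → ι i q ≢ elt

  Carrier : Set
  Carrier = Q ⊎ Σ[ i ∈ Fin k ] Outside i

  Rep : (i : Fin k) → Carrier → P i → Set
  Rep i (inj₁ q)           x = x ≡ ι i q
  Rep i (inj₂ (j , out y _)) x = _≡_ {A = Σ (Fin k) P} (j , y) (i , x)

  Step : Carrier → Carrier → Set
  Step c d = Σ[ i ∈ Fin k ] Σ[ x ∈ P i ] Σ[ y ∈ P i ]
               (Rep i c x × Rep i d y × _≤_ i x y)

  _≤∇_ : Carrier → Carrier → Set
  _≤∇_ = Star Step

delIn : ∀ {n} → Digraph n → Fin n → Digraph n
delIn G v = record
  { adj      = λ a b → adj G a b ∧ not ⌊ b ≟ v ⌋
  ; loopless = λ a → lemma a }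
  where
  open Relation.Binary.PropositionalEquality using (cong)
  lemma : ∀ a → (adj G a a ∧ not ⌊ a ≟ v ⌋) ≡ false
  lemma a = cong (λ x → x ∧ not ⌊ a ≟ v ⌋) (loopless G a)

-- G_v^k ∪ e, where e = (a₀ , v) is an edge of G (so a₀ ≠ v)
addEdge : ∀ {n} → (H : Digraph n) → (a₀ v : Fin n) → a₀ ≢ v → Digraph n
addEdge H a₀ v ne = record
  { adj      = λ a b → adj H a b ∨ (⌊ a ≟ a₀ ⌋ ∧ ⌊ b ≟ v ⌋)
  ; loopless = lemma }
  where
  open Relation.Nullary using (yes; no)
  open Relation.Binary.PropositionalEquality using (refl; sym; trans)
  open import Data.Empty using (⊥-elim)
  lemma : ∀ a → (adj H a a ∨ (⌊ a ≟ a₀ ⌋ ∧ ⌊ a ≟ v ⌋)) ≡ false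
  lemma a with adj H a a | loopless H a | a ≟ a₀ | a ≟ v
  ... | false | _ | no _    | _     = refl
  ... | false | _ | yes _   | no _  = refl
  ... | false | _ | yes p   | yes q = ⊥-elim (ne (trans (sym p) q))
  ... | true  | () | _ | _

delIn⊆addEdge : ∀ {n} (H : Digraph n) (a₀ v : Fin n) (ne : a₀ ≢ v) →
                H ⊆G addEdge H a₀ v ne
delIn⊆addEdge H a₀ v ne a b e = Equivalence.from T-∨ (inj₁ e)

edge≢ : ∀ {n} (G : Digraph n) {a b : Fin n} → Edge G a b → a ≢ b
edge≢ G {a} e refl = lemma (adj G a a) (loopless G a) e
  where
  lemma : ∀ x → x ≡ false → T x → ⊥
  lemma false _ ()
  lemma true () _

Gvk : ∀ {n} → Digraph n → Fin n → Digraph n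
Gvk G v = delIn G v

Gvh : ∀ {n} (G : Digraph n) (v a : Fin n) → Edge G a v → Digraph n
Gvh G v a e = addEdge (Gvk G v) a v (edge≢ G e)

Gvk⊆Gvh : ∀ {n} (G : Digraph n) (v a : Fin n) (e : Edge G a v) →
          Gvk G v ⊆G Gvh G v a e
Gvk⊆Gvh G v a e = delIn⊆addEdge (Gvk G v) a v (edge≢ G e)

module Submission where

open import Defs
open import Data.Nat using (ℕ; _≤_)
open import Data.Fin using (Fin; _≟_; fromℕ<)
open import Data.Fin.Properties using (any?)
open import Data.Product using (Σ; ∃; _×_; _,_; proj₁; proj₂)
open import Data.Sum using (_⊎_; inj₁; inj₂)
open import Data.Bool.Properties using (T-∧; T-∨)
open import Data.Empty using (⊥-elim; ⊥-elim-irr)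
open import Data.List using (List; []; _∷_)
open import Data.List.Relation.Unary.All using (lookup)
open import Data.List.Relation.Unary.Any using (here; there)
open import Data.List.Relation.Unary.AllPairs using (_∷_)
open import Data.List.Relation.Unary.Unique.Propositional using (Unique)
open import Data.List.Membership.Propositional using (_∈_)
open import Relation.Nullary using (¬_; Dec; yes; no)
open import Relation.Nullary.Decidable using (T?; toWitness; fromWitness; toWitnessFalse; fromWitnessFalse)
open import Relation.Binary.PropositionalEquality using (_≡_; _≢_; refl; sym; trans; cong; subst)
open import Relation.Binary.Construct.Closure.ReflexiveTransitive using (ε; _◅_)
open import Function.Bundles using (Equivalence)
open import Function.Definitions using (Injective)
open import Relation.Binary.Morphism.Structures using (IsOrderIsomorphism)

-- In a multipath every vertex has in-degree at most 1.  So a multipath of G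
-- either avoids all edges e₁ … e_k, and is then a multipath of G_v^k, or
-- contains exactly one of them, say e_h, and is then a multipath of G_v^(h)
-- outside P(G_v^k).  This bijection keeps the edge set, and the order of the
-- gluing only ever enlarges edge sets, so it is an order isomorphism.

consec-target∈ : ∀ {n} {x y : Fin n} {xs a c} → Consec (x ∷ y ∷ xs) a c → c ∈ y ∷ xs
consec-target∈ (inj₁ (_ , refl))         = here refl
consec-target∈ {xs = []}    (inj₂ ())
consec-target∈ {xs = _ ∷ _} (inj₂ p) = there (consec-target∈ p)

consec-source-unique : ∀ {n} {xs : List (Fin n)} {a b c} →
                       Unique xs → Consec xs a c → Consec xs b c → a ≡ b
consec-source-unique {xs = _ ∷ _ ∷ _} _ (inj₁ (refl , _)) (inj₁ (refl , _)) = refl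
consec-source-unique {xs = _ ∷ _ ∷ []} _ (inj₁ _) (inj₂ ())
consec-source-unique {xs = _ ∷ _ ∷ []} _ (inj₂ ()) _
consec-source-unique {xs = _ ∷ _ ∷ _ ∷ _} (_ ∷ y∉ ∷ _) (inj₁ (_ , refl)) (inj₂ p) =
  ⊥-elim (lookup y∉ (consec-target∈ p) refl)
consec-source-unique {xs = _ ∷ _ ∷ _ ∷ _} (_ ∷ y∉ ∷ _) (inj₂ p) (inj₁ (_ , refl)) =
  ⊥-elim (lookup y∉ (consec-target∈ p) refl)
consec-source-unique {xs = _ ∷ _ ∷ _} (_ ∷ uq) (inj₂ p) (inj₂ q) = consec-source-unique uq p q

multipath-≡ : ∀ {n} {G : Digraph n} {x y : Multipath G} → mat x ≡ mat y → x ≡ y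
multipath-≡ {x = mpath M _ _} {y = mpath .M _ _} refl = refl

multipath-inNeighbour-unique : ∀ {n} (G : Digraph n) (v : Fin n) (M : Mat n) →
  SubOf M G → IsMultipath M → ∀ {a b} → EdgeM M a v → EdgeM M b v → a ≡ b
multipath-inNeighbour-unique G v M sub mp {a} {b} ea eb with mp v
... | inj₁ trivial = ⊥-elim (edge≢ G (sub a v ea) (trivial a (inj₂ ea ◅ ε)))
... | inj₂ (_ , _ , uq , edges⇒consec , _) =
  consec-source-unique uq (edges⇒consec a v (ea , inj₂ ea ◅ ε))
                          (edges⇒consec b v (eb , inj₂ eb ◅ ε))

module _ {n : ℕ} (G : Digraph n) (v : Fin n) where

  Gvk⊆G : Gvk G v ⊆G G
  Gvk⊆G a b t = proj₁ (Equivalence.to T-∧ t)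

  Gvk-noEdgeInto : ∀ {a} → ¬ Edge (Gvk G v) a v
  Gvk-noEdgeInto t = toWitnessFalse {a? = v ≟ v} (proj₂ (Equivalence.to T-∧ t)) refl

  Gvk-edge : ∀ {a b} → Edge G a b → b ≢ v → Edge (Gvk G v) a b
  Gvk-edge t b≢v = Equivalence.from T-∧ (t , fromWitnessFalse b≢v)

  module _ {a : Fin n} (e : Edge G a v) where

    Gvh-edge-cases : ∀ {b c} → Edge (Gvh G v a e) b c → Edge (Gvk G v) b c ⊎ (b ≡ a × c ≡ v)
    Gvh-edge-cases {b} {c} t with Equivalence.to T-∨ t
    ... | inj₁ t′ = inj₁ t′
    ... | inj₂ t′ with Equivalence.to T-∧ t′
    ...   | b≡a , c≡v = inj₂ (toWitness {a? = b ≟ a} b≡a , toWitness {a? = c ≟ v} c≡v)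

    Gvh⊆G : Gvh G v a e ⊆G G
    Gvh⊆G b c t with Gvh-edge-cases t
    ... | inj₁ t′            = Gvk⊆G b c t′
    ... | inj₂ (refl , refl) = e

    Gvh-edgeInto : ∀ {b} → Edge (Gvh G v a e) b v → b ≡ a
    Gvh-edgeInto t with Gvh-edge-cases t
    ... | inj₁ t′        = ⊥-elim (Gvk-noEdgeInto t′)
    ... | inj₂ (b≡a , _) = b≡a

    Gvh-addedEdge : Edge (Gvh G v a e) a v
    Gvh-addedEdge = Equivalence.from (T-∨ {adj (Gvk G v) a v})
                      (inj₂ (Equivalence.from T-∧ (fromWitness {a? = a ≟ a} refl , fromWitness {a? = v ≟ v} refl)))

  subOf-Gvk : (M : Mat n) → SubOf M G → (∀ a → ¬ EdgeM M a v) → SubOf M (Gvk G v)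
  subOf-Gvk M sub noIn a b t = Gvk-edge (sub a b t) λ { refl → noIn a t }

  subOf-Gvh⇒Gvk : ∀ {a} (e : Edge G a v) (M : Mat n) →
                  SubOf M (Gvh G v a e) → ¬ EdgeM M a v → SubOf M (Gvk G v)
  subOf-Gvh⇒Gvk e M sub noE b c t with Gvh-edge-cases e (sub b c t)
  ... | inj₁ t′            = t′
  ... | inj₂ (refl , refl) = ⊥-elim (noE t)

  subOf-Gvh : (M : Mat n) → SubOf M G → IsMultipath M →
              ∀ {a} (e : Edge G a v) → EdgeM M a v → SubOf M (Gvh G v a e)
  subOf-Gvh M sub mp {a} e ea b c t = byTarget (c ≟ v)
    where
    byTarget : Dec (c ≡ v) → Edge (Gvh G v a e) b c
    byTarget (no c≢v) = Gvk⊆Gvh G v a e b c (Gvk-edge (sub b c t) c≢v)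
    byTarget (yes refl) with multipath-inNeighbour-unique G v M sub mp t ea
    ... | refl = Gvh-addedEdge e

module Isomorphism {n : ℕ} (G : Digraph n) (v : Fin n) (k : ℕ) (2≤k : 2 ≤ k)
    (u : Fin k → Fin n) (u-injective : Injective _≡_ _≡_ u)
    (e : ∀ h → Edge G (u h) v)
    (u-complete : ∀ w → Edge G w v → ∃ λ h → u h ≡ w) where

  Pk : Set
  Pk = Multipath (Gvk G v)

  P : Fin k → Set
  P h = Multipath (Gvh G v (u h) (e h))

  ι : ∀ h → Pk → P h
  ι h = embedP (Gvk⊆Gvh G v (u h) (e h))

  open Gluing Pk P (λ _ → _⊑_) ι

  edges : Carrier → Mat n
  edges (inj₁ q)            = mat q
  edges (inj₂ (_ , out y _)) = mat y

  Rep⇒edges : ∀ h c y → Rep h c y → mat y ≡ edges c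
  Rep⇒edges h (inj₁ q) _ refl               = refl
  Rep⇒edges h (inj₂ (.h , out y _)) .y refl = refl

  ≤∇⇒edges⊆ : ∀ {c d} → c ≤∇ d → ∀ a b → EdgeM (edges c) a b → EdgeM (edges d) a b
  ≤∇⇒edges⊆ ε a b t = t
  ≤∇⇒edges⊆ {c} ((h , x , y , rx , ry , x⊑y) ◅ steps) a b t =
    ≤∇⇒edges⊆ steps a b
      (subst (λ M → EdgeM M a b) (Rep⇒edges h _ y ry)
        (x⊑y a b (subst (λ M → EdgeM M a b) (sym (Rep⇒edges h c x rx)) t)))

  ι-noEdgeInto : ∀ h q {a} → ¬ EdgeM (mat (ι h q)) a v
  ι-noEdgeInto h (mpath _ sub _) t = ⊥-elim-irr (Gvk-noEdgeInto G v (sub _ v t))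

  UsesSome-e : Mat n → Set
  UsesSome-e M = ∃ λ h → EdgeM M (u h) v

  usesSome-e? : ∀ M → Dec (UsesSome-e M)
  usesSome-e? M = any? λ h → T? _

  usesNo-e⇒noEdgeInto : ∀ M → SubOf M G → ¬ UsesSome-e M → ∀ a → ¬ EdgeM M a v
  usesNo-e⇒noEdgeInto M sub noE a t with u-complete a (sub a v t)
  ... | h , refl = noE (h , t)

  classify : (x : Multipath G) → Dec (UsesSome-e (mat x)) → Carrier
  classify (mpath M sub mp) (yes (h , eh)) =
    inj₂ (h , out (mpath M (subOf-Gvh G v M sub mp (e h) eh) mp)
                  λ q q≡ → ι-noEdgeInto h q (subst (λ N → EdgeM N (u h) v) (sym (cong mat q≡)) eh))
  classify (mpath M sub mp) (no noE) =
    inj₁ (mpath M (subOf-Gvk G v M sub (usesNo-e⇒noEdgeInto M sub noE)) mp)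

  toGluing : Multipath G → Carrier
  toGluing x = classify x (usesSome-e? (mat x))

  edges-classify : ∀ x d → edges (classify x d) ≡ mat x
  edges-classify (mpath _ _ _) (yes _) = refl
  edges-classify (mpath _ _ _) (no _)  = refl

  edges-toGluing : ∀ x → edges (toGluing x) ≡ mat x
  edges-toGluing x = edges-classify x (usesSome-e? (mat x))

  injective : ∀ {x y} → toGluing x ≡ toGluing y → x ≡ y
  injective {x} {y} eq =
    multipath-≡ (trans (sym (edges-toGluing x)) (trans (cong edges eq) (edges-toGluing y)))

  cancel : ∀ {x y} → toGluing x ≤∇ toGluing y → x ⊑ y
  cancel {x} {y} le a b t =
    subst (λ M → EdgeM M a b) (edges-toGluing y)
      (≤∇⇒edges⊆ le a b (subst (λ M → EdgeM M a b) (sym (edges-toGluing x)) t))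

  -- Two elements of P(G_v^k) are compared inside some P(G_v^(h)), any index
  -- will do; this is the only place where k ≥ 1 is needed.
  h₀ : Fin k
  h₀ = fromℕ< 2≤k

  classify-step : ∀ x y → x ⊑ y → (dx : Dec (UsesSome-e (mat x))) (dy : Dec (UsesSome-e (mat y))) →
                  Step (classify x dx) (classify y dy)
  classify-step x@(mpath _ _ _) y@(mpath My sy my) x⊑y (yes (h , ex)) (yes (h′ , ey)) = sameIndex (h ≟ h′)
    where
    sameIndex : Dec (h ≡ h′) → Step (classify x (yes (h , ex))) (classify y (yes (h′ , ey)))
    sameIndex (yes refl) = h , _ , _ , refl , refl , x⊑y
    sameIndex (no h≢h′)  =
      ⊥-elim-irr (h≢h′ (u-injective (multipath-inNeighbour-unique G v My sy my (x⊑y _ _ ex) ey)))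
  classify-step x y x⊑y (yes (h , ex)) (no noE) = ⊥-elim (noE (h , x⊑y _ _ ex))
  classify-step (mpath _ _ _) (mpath _ _ _) x⊑y (no _) (yes (h , _)) = h , _ , _ , refl , refl , x⊑y
  classify-step (mpath _ _ _) (mpath _ _ _) x⊑y (no _) (no _) = h₀ , _ , _ , refl , refl , x⊑y

  mono : ∀ {x y} → x ⊑ y → toGluing x ≤∇ toGluing y
  mono {x} {y} x⊑y = classify-step x y x⊑y (usesSome-e? (mat x)) (usesSome-e? (mat y)) ◅ ε

  toGluing-surjective : ∀ c → ∃ λ x → toGluing x ≡ c
  toGluing-surjective (inj₁ q@(mpath _ _ _)) = x , toGluing-x (usesSome-e? (mat x))
    where
    x = embedP (Gvk⊆G G v) q
    toGluing-x : ∀ d → classify x d ≡ inj₁ q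
    toGluing-x (yes (h , eh)) = ⊥-elim (ι-noEdgeInto h q eh)
    toGluing-x (no _)         = refl
  toGluing-surjective (inj₂ (h , out y@(mpath Y sy my) notPk)) = x , toGluing-x (usesSome-e? (mat x))
    where
    x = embedP (Gvh⊆G G v (e h)) y
    toGluing-x : ∀ d → classify x d ≡ inj₂ (h , out y notPk)
    toGluing-x (yes (h′ , eh′)) = sameIndex (h′ ≟ h)
      where
      sameIndex : Dec (h′ ≡ h) → classify x (yes (h′ , eh′)) ≡ inj₂ (h , out y notPk)
      sameIndex (yes refl) = refl
      sameIndex (no h′≢h)  = ⊥-elim-irr (h′≢h (u-injective (Gvh-edgeInto G v (e h) (sy (u h′) v eh′))))
    toGluing-x (no noE) =
      ⊥-elim-irr (notPk (mpath Y (subOf-Gvh⇒Gvk G v (e h) Y sy λ eh → noE (h , eh)) my) refl)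

  isOrderIsomorphism : IsOrderIsomorphism _≡_ _≡_ _⊑_ _≤∇_ toGluing
  isOrderIsomorphism = record
    { isOrderMonomorphism = record
      { isOrderHomomorphism = record { cong = cong toGluing ; mono = mono }
      ; injective = injective
      ; cancel = cancel }
    ; surjective = λ c → proj₁ (toGluing-surjective c) , λ { refl → proj₂ (toGluing-surjective c) } }

theorem3p13 : {n : ℕ} (G : Digraph n) (v : Fin n) (k : ℕ) → 2 ≤ k →
    (u : Fin k → Fin n) → Injective _≡_ _≡_ u →
    (e : ∀ h → Edge G (u h) v) →
    (∀ w → Edge G w v → ∃ λ h → u h ≡ w) →
    Σ (Multipath G → Gluing.Carrier (Multipath (Gvk G v))
                       (λ h → Multipath (Gvh G v (u h) (e h)))
                       (λ h → _⊑_) (λ h → embedP (Gvk⊆Gvh G v (u h) (e h))))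
      (λ f → IsOrderIsomorphism _≡_ _≡_ _⊑_
               (Gluing._≤∇_ (Multipath (Gvk G v))
                  (λ h → Multipath (Gvh G v (u h) (e h)))
                  (λ h → _⊑_) (λ h → embedP (Gvk⊆Gvh G v (u h) (e h))))
               f)
theorem3p13 G v k 2≤k u u-injective e u-complete =
  toGluing , isOrderIsomorphism
  where open Isomorphism G v k 2≤k u u-injective e u-complete
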